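{- Let $C_n=\frac{1}{n+1}\binom{2n}{n}$ be the Catalan numbers. For $n\in\mathbb{N}$, $$C_n\equiv\begin{cases}(-1)^{\delta_3^*(n+1)}\pmod 3&\text{if } n\in T^*(01)-1,\\ 0\pmod 3&\text{otherwise.}\end{cases}$$
   Context: For $m\in\mathbb{N}$ with base-$3$ expansion $m=m_0+3m_1+9m_2+\cdots$, let $T^*(01)$ be the set of $m$ such that $m_i\in\{0,1\}$ for all $i\ge1$ (the digit $m_0$ is unrestricted), and let $\delta_3^*(m)$ be the number of indices $i\ge1$ with $m_i=1$. $T^*(01)-1=\{m-1 : m\in T^*(01)\}$. -}

module Defs where

open import Data.Nat using (ℕ; zero; suc; _+_; _*_; _/_; _%_; _<_)
open import Data.Nat.Combinatorics using (_C_)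
open import Data.List using (List; []; _∷_; filter; length)
open import Data.List.Relation.Unary.All using (All)
open import Relation.Nullary using (¬_)
open import Relation.Binary.PropositionalEquality using (_≡_)
open import Data.Sum using (_⊎_)
open import Data.Nat using (_≟_)
open import Data.Integer using (ℤ) renaming (-_ to -ℤ_)
import Data.Integer as ℤ

catalan : ℕ → ℕ
catalan n = ((2 * n) C n) / suc n

-- base-3 digits, least significant first: digits3 m = [m_0, m_1, ...]
-- (fuel-based; fuel m suffices since m has at most m digits)
digits3-fuel : ℕ → ℕ → List ℕ
digits3-fuel zero    m = []
digits3-fuel (suc f) zero = []
digits3-fuel (suc f) m@(suc _) = (m % 3) ∷ digits3-fuel f (m / 3)

digits3 : ℕ → List ℕ
digits3 m = digits3-fuel m m

Is01 : ℕ → Set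
Is01 d = (d ≡ 0) ⊎ (d ≡ 1)

-- T*(01): all digits m_i with i ≥ 1 are in {0,1}; m_0 unrestricted.
-- The digits m_1, m_2, ... of m are exactly the digits of m / 3.
InTStar01 : ℕ → Set
InTStar01 m = All Is01 (digits3 (m / 3))

δ3* : ℕ → ℕ
δ3* m = length (filter (_≟ 1) (digits3 (m / 3)))

InTStar01-1 : ℕ → Set
InTStar01-1 n = InTStar01 (suc n)

neg1^ : ℕ → ℤ
neg1^ zero = ℤ.+ 1
neg1^ (suc k) = -ℤ (neg1^ k)

-- Write B k for the central binomial coefficient (2k choose k).  Since (1 + x)³ ≡ 1 + x³
-- modulo 3, row 3 + n of Pascal's triangle is congruent to row n plus row n shifted by 3;
-- induction on a and c then gives Lucas' congruence
-- (r + 3a choose s + 3c) ≡ (a choose c)(r choose s) for digits r, s < 3.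
-- Applied to C_n = B n − (2n choose n + 1) it yields C_n ≡ B ⌊(n + 1)/3⌋, and applied to B m
-- it yields the product of B over the base-3 digits of m.  As B 0 = 1, B 1 = 2 ≡ −1 and
-- B 2 = 6 ≡ 0, that product is (−1)^(number of digits 1) when every digit is 0 or 1, and 0
-- otherwise.
module Submission where

open import Defs
open import Data.Nat using (ℕ; suc)
open import Data.Integer using (+_; _-_)
open import Data.Integer.Divisibility using (_∣_)
open import Relation.Nullary using (¬_)
open import Data.Product using (_×_)

open import Data.Nat using (zero; _+_; _*_; _∸_; _^_; _/_; _%_; _≤_; _<_; z≤n; s≤s; _≟_)
open import Data.Nat.Properties
  using ( +-identityʳ; +-comm; +-cancelˡ-≡; *-comm; *-suc; *-zeroʳ; *-identityʳ
        ; *-distribˡ-+; *-distribʳ-+; *-distribʳ-∸; m+n∸n≡m; m+n∸m≡n; m∸n+n≡m; *-cancelˡ-≤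
        ; ≤-reflexive; m≤m+n; m≤n+m; ≤-trans; <-≤-trans; ≤-refl; ≤-pred)
open import Data.Nat.DivMod
  using ( m≡m%n+[m/n]*n; [m+kn]%n≡m%n; %-distribˡ-+; %-distribˡ-*; m%n<n; m/n<m
        ; m*n/n≡m; m<n⇒m/n≡0; +-distrib-/-∣ʳ; _divMod_; result)
open import Data.Nat.Divisibility using (m%n≡0⇒n∣m; divides)
open import Data.Nat.Combinatorics
  using (_C_; nCk+nC[k+1]≡[n+1]C[k+1]; nC1≡n; nCk≡nC[n∸k]; k>n⇒nCk≡0)
open import Data.Nat.Tactic.RingSolver using (solve-∀)
open import Data.Integer using (-[1+_]) renaming (-_ to -ℤ_)
open import Data.Fin using (zero; suc)
open import Data.List using ([]; _∷_; map; filter; length)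
open import Data.Nat.ListAction using (product)
open import Data.List.Relation.Unary.All using (All; []; _∷_)
open import Data.Product using (_,_)
open import Data.Sum using (_⊎_; inj₁; inj₂)
open import Data.Empty using (⊥-elim)
open import Function using (_∘_)
open import Level using (0ℓ)
open import Relation.Binary using (IsEquivalence; Setoid)
import Relation.Binary.Reasoning.Setoid as SetoidReasoning
open import Relation.Binary.PropositionalEquality
  using (_≡_; refl; sym; trans; cong; cong₂; subst; module ≡-Reasoning)

0<3 : 0 < 3
0<3 = s≤s z≤n

1<3 : 1 < 3
1<3 = s≤s (s≤s z≤n)

2<3 : 2 < 3
2<3 = s≤s (s≤s (s≤s z≤n))

infix 4 _≡_[mod3]

record _≡_[mod3] (x y : ℕ) : Set where
  constructor mod3
  field residue-≡ : x % 3 ≡ y % 3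

≡mod3-isEquivalence : IsEquivalence _≡_[mod3]
≡mod3-isEquivalence = record
  { refl  = mod3 refl
  ; sym   = λ (mod3 p) → mod3 (sym p)
  ; trans = λ (mod3 p) (mod3 q) → mod3 (trans p q)
  }

≡mod3-setoid : Setoid 0ℓ 0ℓ
≡mod3-setoid = record { isEquivalence = ≡mod3-isEquivalence }

module ≡mod3 = IsEquivalence ≡mod3-isEquivalence
module ≡mod3-Reasoning = SetoidReasoning ≡mod3-setoid

+-cong : ∀ {a b c d} → a ≡ b [mod3] → c ≡ d [mod3] → a + c ≡ b + d [mod3]
+-cong {a} {b} {c} {d} (mod3 p) (mod3 q) = mod3 (begin
  (a + c) % 3             ≡⟨ %-distribˡ-+ a c 3 ⟩
  (a % 3 + c % 3) % 3     ≡⟨ cong₂ (λ x y → (x + y) % 3) p q ⟩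
  (b % 3 + d % 3) % 3     ≡⟨ %-distribˡ-+ b d 3 ⟨
  (b + d) % 3             ∎)
  where open ≡-Reasoning

*-cong : ∀ {a b c d} → a ≡ b [mod3] → c ≡ d [mod3] → a * c ≡ b * d [mod3]
*-cong {a} {b} {c} {d} (mod3 p) (mod3 q) = mod3 (begin
  (a * c) % 3             ≡⟨ %-distribˡ-* a c 3 ⟩
  (a % 3 * (c % 3)) % 3   ≡⟨ cong₂ (λ x y → (x * y) % 3) p q ⟩
  (b % 3 * (d % 3)) % 3   ≡⟨ %-distribˡ-* b d 3 ⟨
  (b * d) % 3             ∎)
  where open ≡-Reasoning

*-congˡ : ∀ a {c d} → c ≡ d [mod3] → a * c ≡ a * d [mod3]
*-congˡ a = *-cong {a} ≡mod3.refl

x+y*3≡x : ∀ x y → x + y * 3 ≡ x [mod3]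
x+y*3≡x x y = mod3 ([m+kn]%n≡m%n x y 3)

x+y≡z⇒x≡z+2y : ∀ {x y z} → x + y ≡ z → x ≡ z + 2 * y [mod3]
x+y≡z⇒x≡z+2y {x} {y} {z} x+y≡z = begin
  x                   ≈⟨ x+y*3≡x x y ⟨
  x + y * 3           ≡⟨ regroup x y ⟩
  (x + y) + 2 * y     ≡⟨ cong (_+ 2 * y) x+y≡z ⟩
  z + 2 * y           ∎
  where
  open ≡mod3-Reasoning
  regroup : ∀ x y → x + y * 3 ≡ (x + y) + 2 * y
  regroup = solve-∀

[r+q*3]/3≡q : ∀ {r} q → r < 3 → (r + q * 3) / 3 ≡ q
[r+q*3]/3≡q {r} q r<3 = begin
  (r + q * 3) / 3         ≡⟨ +-distrib-/-∣ʳ r (divides q refl) ⟩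
  r / 3 + q * 3 / 3       ≡⟨ cong₂ _+_ (m<n⇒m/n≡0 r<3) (m*n/n≡m q 3) ⟩
  q                       ∎
  where open ≡-Reasoning

pascal : ∀ n k → suc n C suc k ≡ n C k + n C suc k
pascal n k = sym (nCk+nC[k+1]≡[n+1]C[k+1] n k)

[3+n]C[3+k]-expand : ∀ n k →
  (3 + n) C (3 + k) ≡ (n C k + n C (3 + k)) + (n C (1 + k) + n C (2 + k)) * 3
[3+n]C[3+k]-expand n k = begin
  (3 + n) C (3 + k)
    ≡⟨ pascal (2 + n) (2 + k) ⟩
  (2 + n) C (2 + k) + (2 + n) C (3 + k)
    ≡⟨ cong₂ _+_ (pascal (1 + n) (1 + k)) (pascal (1 + n) (2 + k)) ⟩
  ((1 + n) C (1 + k) + (1 + n) C (2 + k)) + ((1 + n) C (2 + k) + (1 + n) C (3 + k))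
    ≡⟨ cong₂ _+_ (cong₂ _+_ (pascal n k) (pascal n (1 + k)))
                 (cong₂ _+_ (pascal n (1 + k)) (pascal n (2 + k))) ⟩
  ((n C k + n C (1 + k)) + (n C (1 + k) + n C (2 + k)))
    + ((n C (1 + k) + n C (2 + k)) + (n C (2 + k) + n C (3 + k)))
    ≡⟨ regroup (n C k) (n C (1 + k)) (n C (2 + k)) (n C (3 + k)) ⟩
  (n C k + n C (3 + k)) + (n C (1 + k) + n C (2 + k)) * 3
    ∎
  where
  open ≡-Reasoning
  regroup : ∀ a b c d → ((a + b) + (b + c)) + ((b + c) + (c + d)) ≡ (a + d) + (b + c) * 3
  regroup = solve-∀

[3+n]C[3+k]≡nCk+nC[3+k] : ∀ n k → (3 + n) C (3 + k) ≡ n C k + n C (3 + k) [mod3]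
[3+n]C[3+k]≡nCk+nC[3+k] n k = ≡mod3.trans
  (≡mod3.reflexive ([3+n]C[3+k]-expand n k))
  (x+y*3≡x (n C k + n C (3 + k)) (n C (1 + k) + n C (2 + k)))

[3+n]Ck≡nCk : ∀ n {k} → k < 3 → (3 + n) C k ≡ n C k [mod3]
[3+n]Ck≡nCk n {0} _ = ≡mod3.refl
[3+n]Ck≡nCk n {1} _ = begin
  (3 + n) C 1   ≡⟨ nC1≡n (3 + n) ⟩
  3 + n         ≡⟨ +-comm 3 n ⟩
  n + 1 * 3     ≈⟨ x+y*3≡x n 1 ⟩
  n             ≡⟨ nC1≡n n ⟨
  n C 1         ∎
  where open ≡mod3-Reasoning
[3+n]Ck≡nCk n {2} _ = begin
  (3 + n) C 2
    ≡⟨ pascal (2 + n) 1 ⟩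
  (2 + n) C 1 + (2 + n) C 2
    ≡⟨ cong (λ x → (2 + n) C 1 + x) (pascal (1 + n) 1) ⟩
  (2 + n) C 1 + ((1 + n) C 1 + (1 + n) C 2)
    ≡⟨ cong (λ x → (2 + n) C 1 + ((1 + n) C 1 + x)) (pascal n 1) ⟩
  (2 + n) C 1 + ((1 + n) C 1 + (n C 1 + n C 2))
    ≡⟨ cong₂ (λ x y → x + (y + (n C 1 + n C 2))) (nC1≡n (2 + n)) (nC1≡n (1 + n)) ⟩
  (2 + n) + ((1 + n) + (n C 1 + n C 2))
    ≡⟨ cong (λ x → (2 + n) + ((1 + n) + (x + n C 2))) (nC1≡n n) ⟩
  (2 + n) + ((1 + n) + (n + n C 2))
    ≡⟨ regroup n (n C 2) ⟩
  n C 2 + (1 + n) * 3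
    ≈⟨ x+y*3≡x (n C 2) (1 + n) ⟩
  n C 2
    ∎
  where
  open ≡mod3-Reasoning
  regroup : ∀ n x → (2 + n) + ((1 + n) + (n + x)) ≡ x + (1 + n) * 3
  regroup = solve-∀
[3+n]Ck≡nCk n {suc (suc (suc _))} (s≤s (s≤s (s≤s ())))

r+[1+a]*3≡3+[r+a*3] : ∀ a r → r + suc a * 3 ≡ 3 + (r + a * 3)
r+[1+a]*3≡3+[r+a*3] = solve-∀

lucas : ∀ {r s} → r < 3 → s < 3 → ∀ a c → (r + a * 3) C (s + c * 3) ≡ (a C c) * (r C s) [mod3]
lucas {r} {s} r<3 s<3 zero zero = ≡mod3.reflexive (begin
  (r + 0) C (s + 0)   ≡⟨ cong₂ _C_ (+-identityʳ r) (+-identityʳ s) ⟩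
  r C s               ≡⟨ +-identityʳ (r C s) ⟨
  1 * (r C s)         ∎)
  where open ≡-Reasoning
lucas {r} {s} r<3 s<3 zero (suc c) = ≡mod3.reflexive (begin
  (r + 0) C (s + suc c * 3)   ≡⟨ k>n⇒nCk≡0 r+0<s+[1+c]*3 ⟩
  0                           ∎)
  where
  open ≡-Reasoning
  r+0<s+[1+c]*3 : r + 0 < s + suc c * 3
  r+0<s+[1+c]*3 = <-≤-trans (subst (_< 3) (sym (+-identityʳ r)) r<3)
                            (≤-trans (m≤m+n 3 (c * 3)) (m≤n+m (suc c * 3) s))
lucas {r} {s} r<3 s<3 (suc a) zero = begin
  (r + suc a * 3) C (s + 0)     ≡⟨ cong₂ _C_ (r+[1+a]*3≡3+[r+a*3] a r) (+-identityʳ s) ⟩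
  (3 + (r + a * 3)) C s         ≈⟨ [3+n]Ck≡nCk (r + a * 3) s<3 ⟩
  (r + a * 3) C s               ≡⟨ cong ((r + a * 3) C_) (+-identityʳ s) ⟨
  (r + a * 3) C (s + 0)         ≈⟨ lucas r<3 s<3 a zero ⟩
  (a C 0) * (r C s)             ∎
  where open ≡mod3-Reasoning
lucas {r} {s} r<3 s<3 (suc a) (suc c) = begin
  (r + suc a * 3) C (s + suc c * 3)
    ≡⟨ cong₂ _C_ (r+[1+a]*3≡3+[r+a*3] a r) (r+[1+a]*3≡3+[r+a*3] c s) ⟩
  (3 + (r + a * 3)) C (3 + (s + c * 3))
    ≈⟨ [3+n]C[3+k]≡nCk+nC[3+k] (r + a * 3) (s + c * 3) ⟩
  (r + a * 3) C (s + c * 3) + (r + a * 3) C (3 + (s + c * 3))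
    ≡⟨ cong (λ k → (r + a * 3) C (s + c * 3) + (r + a * 3) C k) (r+[1+a]*3≡3+[r+a*3] c s) ⟨
  (r + a * 3) C (s + c * 3) + (r + a * 3) C (s + suc c * 3)
    ≈⟨ +-cong (lucas r<3 s<3 a c) (lucas r<3 s<3 a (suc c)) ⟩
  (a C c) * (r C s) + (a C suc c) * (r C s)
    ≡⟨ *-distribʳ-+ (r C s) (a C c) (a C suc c) ⟨
  (a C c + a C suc c) * (r C s)
    ≡⟨ cong (_* (r C s)) (nCk+nC[k+1]≡[n+1]C[k+1] a c) ⟩
  (suc a C suc c) * (r C s)
    ∎
  where open ≡mod3-Reasoning

centralBinomial : ℕ → ℕ
centralBinomial k = (2 * k) C k

lucas-double : ∀ {r s} → 2 * r < 3 → s < 3 → ∀ q c →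
  (2 * (r + q * 3)) C (s + c * 3) ≡ ((2 * q) C c) * ((2 * r) C s) [mod3]
lucas-double {r} {s} 2r<3 s<3 q c = ≡mod3.trans
  (≡mod3.reflexive (cong (_C (s + c * 3)) (2*[r+q*3]≡2r+2q*3 r q)))
  (lucas 2r<3 s<3 (2 * q) c)
  where
  2*[r+q*3]≡2r+2q*3 : ∀ r q → 2 * (r + q * 3) ≡ 2 * r + (2 * q) * 3
  2*[r+q*3]≡2r+2q*3 = solve-∀

lucas-carry : ∀ {s} → s < 3 → ∀ q c →
  (2 * (2 + q * 3)) C (s + c * 3) ≡ (suc (2 * q) C c) * (1 C s) [mod3]
lucas-carry {s} s<3 q c = ≡mod3.trans
  (≡mod3.reflexive (cong (_C (s + c * 3)) (2*[2+q*3]≡1+[1+2q]*3 q)))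
  (lucas 1<3 s<3 (suc (2 * q)) c)
  where
  2*[2+q*3]≡1+[1+2q]*3 : ∀ q → 2 * (2 + q * 3) ≡ 1 + suc (2 * q) * 3
  2*[2+q*3]≡1+[1+2q]*3 = solve-∀

centralBinomial-digit : ∀ q {r} → r < 3 →
  centralBinomial (r + q * 3) ≡ centralBinomial r * centralBinomial q [mod3]
centralBinomial-digit q {0} _ = ≡mod3.trans (lucas-double {0} 0<3 0<3 q q)
  (≡mod3.reflexive (*-comm (centralBinomial q) 1))
centralBinomial-digit q {1} _ = ≡mod3.trans (lucas-double {1} 2<3 1<3 q q)
  (≡mod3.reflexive (*-comm (centralBinomial q) 2))
centralBinomial-digit q {2} _ = begin
  centralBinomial (2 + q * 3)             ≈⟨ lucas-carry 2<3 q q ⟩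
  (suc (2 * q) C q) * 0                   ≡⟨ *-zeroʳ (suc (2 * q) C q) ⟩
  0                                       ≈⟨ x+y*3≡x 0 (2 * centralBinomial q) ⟨
  (2 * centralBinomial q) * 3             ≡⟨ 6x≡2x*3 (centralBinomial q) ⟨
  6 * centralBinomial q                   ∎
  where
  open ≡mod3-Reasoning
  6x≡2x*3 : ∀ x → 6 * x ≡ (2 * x) * 3
  6x≡2x*3 = solve-∀
centralBinomial-digit q {suc (suc (suc _))} (s≤s (s≤s (s≤s ())))

centralBinomial-suc : ∀ q → centralBinomial (suc q) ≡ 2 * (suc (2 * q) C suc q)
centralBinomial-suc q = begin
  (2 * suc q) C suc q                         ≡⟨ cong (_C suc q) (*-suc 2 q) ⟩
  suc (suc (2 * q)) C suc q                   ≡⟨ pascal (suc (2 * q)) q ⟩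
  suc (2 * q) C q + suc (2 * q) C suc q       ≡⟨ cong (_+ suc (2 * q) C suc q) symmetric ⟩
  suc (2 * q) C suc q + suc (2 * q) C suc q   ≡⟨ x+x≡2x (suc (2 * q) C suc q) ⟩
  2 * (suc (2 * q) C suc q)                   ∎
  where
  open ≡-Reasoning
  x+x≡2x : ∀ x → x + x ≡ 2 * x
  x+x≡2x = solve-∀
  1+2q≡q+[1+q] : ∀ q → suc (2 * q) ≡ q + suc q
  1+2q≡q+[1+q] = solve-∀
  q≤1+2q : q ≤ suc (2 * q)
  q≤1+2q = ≤-trans (m≤m+n q (suc q)) (≤-reflexive (sym (1+2q≡q+[1+q] q)))
  symmetric : suc (2 * q) C q ≡ suc (2 * q) C suc q
  symmetric = begin
    suc (2 * q) C q                   ≡⟨ nCk≡nC[n∸k] q≤1+2q ⟩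
    suc (2 * q) C (suc (2 * q) ∸ q)   ≡⟨ cong (λ n → suc (2 * q) C (n ∸ q)) (1+2q≡q+[1+q] q) ⟩
    suc (2 * q) C (q + suc q ∸ q)     ≡⟨ cong (suc (2 * q) C_) (m+n∸m≡n q (suc q)) ⟩
    suc (2 * q) C suc q               ∎

[1+k]*[1+n]C[1+k]≡[1+n]*nCk : ∀ n k → suc k * (suc n C suc k) ≡ suc n * (n C k)
[1+k]*[1+n]C[1+k]≡[1+n]*nCk zero zero = refl
[1+k]*[1+n]C[1+k]≡[1+n]*nCk zero (suc k) = *-zeroʳ (suc (suc k))
[1+k]*[1+n]C[1+k]≡[1+n]*nCk (suc n) zero = begin
  suc (suc n) C 1 + 0     ≡⟨ +-identityʳ _ ⟩
  suc (suc n) C 1         ≡⟨ nC1≡n (suc (suc n)) ⟩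
  suc (suc n)             ≡⟨ *-identityʳ (suc (suc n)) ⟨
  suc (suc n) * 1         ∎
  where open ≡-Reasoning
[1+k]*[1+n]C[1+k]≡[1+n]*nCk (suc n) (suc k) = begin
  suc (suc k) * (suc m C suc (suc k))
    ≡⟨ cong (suc (suc k) *_) (pascal m (suc k)) ⟩
  suc (suc k) * (m C suc k + m C suc (suc k))
    ≡⟨ *-distribˡ-+ (suc (suc k)) (m C suc k) (m C suc (suc k)) ⟩
  (m C suc k + suc k * (m C suc k)) + suc (suc k) * (m C suc (suc k))
    ≡⟨ cong₂ (λ x y → (m C suc k + x) + y) ([1+k]*[1+n]C[1+k]≡[1+n]*nCk n k)
                                           ([1+k]*[1+n]C[1+k]≡[1+n]*nCk n (suc k)) ⟩
  (m C suc k + m * (n C k)) + m * (n C suc k)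
    ≡⟨ regroup (m C suc k) m (n C k) (n C suc k) ⟩
  m C suc k + m * (n C k + n C suc k)
    ≡⟨ cong (λ x → m C suc k + m * x) (nCk+nC[k+1]≡[n+1]C[k+1] n k) ⟩
  suc m * (m C suc k)
    ∎
  where
  open ≡-Reasoning
  m = suc n
  regroup : ∀ a m x y → (a + m * x) + m * y ≡ a + m * (x + y)
  regroup = solve-∀

[1+n]*[2n]C[1+n]≡n*[2n]Cn : ∀ n → suc n * ((2 * n) C suc n) ≡ n * centralBinomial n
[1+n]*[2n]C[1+n]≡n*[2n]Cn n = +-cancelˡ-≡ (suc n * b) (suc n * d) (n * b) (begin
  suc n * b + suc n * d           ≡⟨ *-distribˡ-+ (suc n) b d ⟨
  suc n * (b + d)                 ≡⟨ cong (suc n *_) (nCk+nC[k+1]≡[n+1]C[k+1] (2 * n) n) ⟩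
  suc n * (suc (2 * n) C suc n)   ≡⟨ [1+k]*[1+n]C[1+k]≡[1+n]*nCk (2 * n) n ⟩
  suc (2 * n) * b                 ≡⟨ cong (_* b) (1+2n≡[1+n]+n n) ⟩
  (suc n + n) * b                 ≡⟨ *-distribʳ-+ b (suc n) n ⟩
  suc n * b + n * b               ∎)
  where
  open ≡-Reasoning
  b = centralBinomial n
  d = (2 * n) C suc n
  1+2n≡[1+n]+n : ∀ n → suc (2 * n) ≡ suc n + n
  1+2n≡[1+n]+n = solve-∀

catalan+[2n]C[1+n]≡[2n]Cn : ∀ n → catalan n + (2 * n) C suc n ≡ centralBinomial n
catalan+[2n]C[1+n]≡[2n]Cn n = begin
  b / suc n + d                   ≡⟨ cong (λ x → x / suc n + d) [b∸d]*[1+n]≡b ⟨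
  (b ∸ d) * suc n / suc n + d     ≡⟨ cong (_+ d) (m*n/n≡m (b ∸ d) (suc n)) ⟩
  (b ∸ d) + d                     ≡⟨ m∸n+n≡m d≤b ⟩
  b                               ∎
  where
  open ≡-Reasoning
  b = centralBinomial n
  d = (2 * n) C suc n
  [1+n]d≡nb : suc n * d ≡ n * b
  [1+n]d≡nb = [1+n]*[2n]C[1+n]≡n*[2n]Cn n
  [b∸d]*[1+n]≡b : (b ∸ d) * suc n ≡ b
  [b∸d]*[1+n]≡b = begin
    (b ∸ d) * suc n             ≡⟨ *-distribʳ-∸ (suc n) b d ⟩
    b * suc n ∸ d * suc n       ≡⟨ cong₂ _∸_ (*-comm b (suc n)) (trans (*-comm d (suc n)) [1+n]d≡nb) ⟩
    (b + n * b) ∸ n * b         ≡⟨ m+n∸n≡m b (n * b) ⟩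
    b                           ∎
  d≤b : d ≤ b
  d≤b = *-cancelˡ-≤ (suc n) (subst (_≤ suc n * b) (sym [1+n]d≡nb) (m≤n+m (n * b) b))

catalan≡[2n]Cn+2*[2n]C[1+n] : ∀ n → catalan n ≡ centralBinomial n + 2 * ((2 * n) C suc n) [mod3]
catalan≡[2n]Cn+2*[2n]C[1+n] n = x+y≡z⇒x≡z+2y (catalan+[2n]C[1+n]≡[2n]Cn n)

catalan[q*3]≡central[q] : ∀ q → catalan (q * 3) ≡ centralBinomial q [mod3]
catalan[q*3]≡central[q] q = begin
  catalan (q * 3)
    ≈⟨ catalan≡[2n]Cn+2*[2n]C[1+n] (q * 3) ⟩
  centralBinomial (q * 3) + 2 * ((2 * (q * 3)) C suc (q * 3))
    ≈⟨ +-cong (lucas-double {0} 0<3 0<3 q q) (*-congˡ 2 (lucas-double {0} 0<3 1<3 q q)) ⟩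
  centralBinomial q * 1 + 2 * (centralBinomial q * 0)
    ≡⟨ x*1+2*[x*0]≡x (centralBinomial q) ⟩
  centralBinomial q
    ∎
  where
  open ≡mod3-Reasoning
  x*1+2*[x*0]≡x : ∀ x → x * 1 + 2 * (x * 0) ≡ x
  x*1+2*[x*0]≡x = solve-∀

catalan[1+q*3]≡central[q] : ∀ q → catalan (1 + q * 3) ≡ centralBinomial q [mod3]
catalan[1+q*3]≡central[q] q = begin
  catalan (1 + q * 3)
    ≈⟨ catalan≡[2n]Cn+2*[2n]C[1+n] (1 + q * 3) ⟩
  centralBinomial (1 + q * 3) + 2 * ((2 * (1 + q * 3)) C (2 + q * 3))
    ≈⟨ +-cong (lucas-double {1} 2<3 1<3 q q) (*-congˡ 2 (lucas-double {1} 2<3 2<3 q q)) ⟩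
  centralBinomial q * 2 + 2 * (centralBinomial q * 1)
    ≡⟨ x*2+2*[x*1]≡x+x*3 (centralBinomial q) ⟩
  centralBinomial q + centralBinomial q * 3
    ≈⟨ x+y*3≡x (centralBinomial q) (centralBinomial q) ⟩
  centralBinomial q
    ∎
  where
  open ≡mod3-Reasoning
  x*2+2*[x*1]≡x+x*3 : ∀ x → x * 2 + 2 * (x * 1) ≡ x + x * 3
  x*2+2*[x*1]≡x+x*3 = solve-∀

catalan[2+q*3]≡central[1+q] : ∀ q → catalan (2 + q * 3) ≡ centralBinomial (suc q) [mod3]
catalan[2+q*3]≡central[1+q] q = begin
  catalan (2 + q * 3)
    ≈⟨ catalan≡[2n]Cn+2*[2n]C[1+n] (2 + q * 3) ⟩
  centralBinomial (2 + q * 3) + 2 * ((2 * (2 + q * 3)) C (0 + suc q * 3))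
    ≈⟨ +-cong (lucas-carry 2<3 q q) (*-congˡ 2 (lucas-carry 0<3 q (suc q))) ⟩
  (suc (2 * q) C q) * 0 + 2 * ((suc (2 * q) C suc q) * 1)
    ≡⟨ x*0+2*[y*1]≡2y (suc (2 * q) C q) (suc (2 * q) C suc q) ⟩
  2 * (suc (2 * q) C suc q)
    ≡⟨ centralBinomial-suc q ⟨
  centralBinomial (suc q)
    ∎
  where
  open ≡mod3-Reasoning
  x*0+2*[y*1]≡2y : ∀ x y → x * 0 + 2 * (y * 1) ≡ 2 * y
  x*0+2*[y*1]≡2y = solve-∀

catalan≡central[[1+n]/3] : ∀ n → catalan n ≡ centralBinomial (suc n / 3) [mod3]
catalan≡central[[1+n]/3] n with n divMod 3
... | result q zero refl rewrite [r+q*3]/3≡q q 1<3 = catalan[q*3]≡central[q] q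
... | result q (suc zero) refl rewrite [r+q*3]/3≡q q 2<3 = catalan[1+q*3]≡central[q] q
... | result q (suc (suc zero)) refl rewrite [r+q*3]/3≡q (suc q) 0<3 = catalan[2+q*3]≡central[1+q] q

centralBinomial≡central[%3]*central[/3] : ∀ m →
  centralBinomial m ≡ centralBinomial (m % 3) * centralBinomial (m / 3) [mod3]
centralBinomial≡central[%3]*central[/3] m =
  subst (λ k → centralBinomial k ≡ centralBinomial (m % 3) * centralBinomial (m / 3) [mod3])
        (sym (m≡m%n+[m/n]*n m 3))
        (centralBinomial-digit (m / 3) (m%n<n m 3))

centralBinomial≡∏digits-fuel : ∀ f m → m ≤ f →
  centralBinomial m ≡ product (map centralBinomial (digits3-fuel f m)) [mod3]
centralBinomial≡∏digits-fuel zero zero _ = ≡mod3.refl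
centralBinomial≡∏digits-fuel (suc f) zero _ = ≡mod3.refl
centralBinomial≡∏digits-fuel (suc f) (suc m) (s≤s m≤f) = ≡mod3.trans
  (centralBinomial≡central[%3]*central[/3] (suc m))
  (*-congˡ (centralBinomial (suc m % 3)) (centralBinomial≡∏digits-fuel f (suc m / 3) [1+m]/3≤f))
  where
  [1+m]/3≤f : suc m / 3 ≤ f
  [1+m]/3≤f = ≤-trans (≤-pred (m/n<m (suc m) 3 1<3)) m≤f

centralBinomial≡∏digits : ∀ m → centralBinomial m ≡ product (map centralBinomial (digits3 m)) [mod3]
centralBinomial≡∏digits m = centralBinomial≡∏digits-fuel m m ≤-refl

digits3-fuel<3 : ∀ f m → All (_< 3) (digits3-fuel f m)
digits3-fuel<3 zero m = []
digits3-fuel<3 (suc f) zero = []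
digits3-fuel<3 (suc f) (suc m) = m%n<n (suc m) 3 ∷ digits3-fuel<3 f (suc m / 3)

∏central≡2^#1 : ∀ {ds} → All Is01 ds →
  product (map centralBinomial ds) ≡ 2 ^ length (filter (_≟ 1) ds)
∏central≡2^#1 [] = refl
∏central≡2^#1 (inj₁ refl ∷ ds∈01) = trans (+-identityʳ _) (∏central≡2^#1 ds∈01)
∏central≡2^#1 (inj₂ refl ∷ ds∈01) = cong (2 *_) (∏central≡2^#1 ds∈01)

∏central≡0 : ∀ {ds} → All (_< 3) ds → ¬ All Is01 ds →
  product (map centralBinomial ds) ≡ 0 [mod3]
∏central≡0 [] ds∉01 = ⊥-elim (ds∉01 [])
∏central≡0 {0 ∷ _} (_ ∷ ds<3) ds∉01 =
  *-congˡ 1 (∏central≡0 ds<3 (ds∉01 ∘ (inj₁ refl ∷_)))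
∏central≡0 {1 ∷ _} (_ ∷ ds<3) ds∉01 =
  *-congˡ 2 (∏central≡0 ds<3 (ds∉01 ∘ (inj₂ refl ∷_)))
∏central≡0 {2 ∷ ds} _ _ = ≡mod3.trans
  (≡mod3.reflexive (6x≡0+2x*3 (product (map centralBinomial ds))))
  (x+y*3≡x 0 (2 * product (map centralBinomial ds)))
  where
  6x≡0+2x*3 : ∀ x → 6 * x ≡ 0 + (2 * x) * 3
  6x≡0+2x*3 = solve-∀
∏central≡0 {suc (suc (suc _)) ∷ _} (s≤s (s≤s (s≤s ())) ∷ _) _

neg1^≡2^ : ∀ k →
  (neg1^ k ≡ + 1 × (2 ^ k ≡ 1 [mod3])) ⊎ (neg1^ k ≡ -[1+ 0 ] × (2 ^ k ≡ 2 [mod3]))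
neg1^≡2^ zero = inj₁ (refl , ≡mod3.refl)
neg1^≡2^ (suc k) with neg1^≡2^ k
... | inj₁ (sign , 2^k≡1) = inj₂ (cong -ℤ_ sign , *-congˡ 2 2^k≡1)
... | inj₂ (sign , 2^k≡2) = inj₁ (cong -ℤ_ sign , ≡mod3.trans (*-congˡ 2 2^k≡2) (mod3 refl))

≡0⇒3∣ : ∀ {x} → x ≡ 0 [mod3] → (+ 3) ∣ (+ x)
≡0⇒3∣ {x} (mod3 x%3≡0) = m%n≡0⇒n∣m x 3 x%3≡0

-- The witness needs no proof: ∣ + (1 + m) - + 1 ∣ reduces to m.
≡1⇒3∣[x-1] : ∀ {x} → x ≡ 1 [mod3] → (+ 3) ∣ (+ x - + 1)
≡1⇒3∣[x-1] {x} (mod3 x%3≡1) =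
  subst (λ y → (+ 3) ∣ (+ y - + 1)) (sym x≡1+t*3) (divides (x / 3) refl)
  where
  x≡1+t*3 : x ≡ 1 + x / 3 * 3
  x≡1+t*3 = trans (m≡m%n+[m/n]*n x 3) (cong (_+ x / 3 * 3) x%3≡1)

≡2⇒3∣[x+1] : ∀ {x} → x ≡ 2 [mod3] → (+ 3) ∣ (+ x - -[1+ 0 ])
≡2⇒3∣[x+1] {x} (mod3 x%3≡2) = divides (suc (x / 3)) (begin
  x + 1                 ≡⟨ cong (_+ 1) (trans (m≡m%n+[m/n]*n x 3) (cong (_+ x / 3 * 3) x%3≡2)) ⟩
  2 + x / 3 * 3 + 1     ≡⟨ +-comm (2 + x / 3 * 3) 1 ⟩
  suc (x / 3) * 3       ∎)
  where open ≡-Reasoning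

≡2^k⇒3∣[x-neg1^k] : ∀ {x} k → x ≡ 2 ^ k [mod3] → (+ 3) ∣ (+ x - neg1^ k)
≡2^k⇒3∣[x-neg1^k] {x} k x≡2^k with neg1^≡2^ k
... | inj₁ (sign , 2^k≡1) =
  subst (λ z → (+ 3) ∣ (+ x - z)) (sym sign) (≡1⇒3∣[x-1] (≡mod3.trans x≡2^k 2^k≡1))
... | inj₂ (sign , 2^k≡2) =
  subst (λ z → (+ 3) ∣ (+ x - z)) (sym sign) (≡2⇒3∣[x+1] (≡mod3.trans x≡2^k 2^k≡2))

theorem5p2 : (n : ℕ) →
    (InTStar01-1 n → (+ 3) ∣ ((+ catalan n) - neg1^ (δ3* (suc n))))
    × (¬ InTStar01-1 n → (+ 3) ∣ (+ catalan n))
theorem5p2 n = digits∈01⇒ , digits∉01⇒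
  where
  ds = digits3 (suc n / 3)
  catalan≡∏ : catalan n ≡ product (map centralBinomial ds) [mod3]
  catalan≡∏ = ≡mod3.trans (catalan≡central[[1+n]/3] n) (centralBinomial≡∏digits (suc n / 3))
  digits∈01⇒ : All Is01 ds → (+ 3) ∣ ((+ catalan n) - neg1^ (δ3* (suc n)))
  digits∈01⇒ ds∈01 = ≡2^k⇒3∣[x-neg1^k] (δ3* (suc n))
    (≡mod3.trans catalan≡∏ (≡mod3.reflexive (∏central≡2^#1 ds∈01)))
  digits∉01⇒ : ¬ All Is01 ds → (+ 3) ∣ (+ catalan n)
  digits∉01⇒ ds∉01 =
    ≡0⇒3∣ (≡mod3.trans catalan≡∏ (∏central≡0 (digits3-fuel<3 (suc n / 3) _) ds∉01))
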